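{- Let $Q$ be a finite (left) quasifield with $q$ elements. If $A \subset Q \setminus \{0\}$, $|A+A| = m$ and $|A \cdot A| = n$, then \[ |A|^2 \leq \frac{mn|A|}{q} + q^{1/2}\sqrt{mn}. \]
   Context: A (left) quasifield is a set $Q$ with two binary operations $+$ and $\cdot$ such that $(Q,+)$ is a group with identity $0$; $(Q\setminus\{0\},\cdot)$ is a loop (for all $a,b$ the equations $a\cdot x=b$ and $y\cdot a=b$ have unique solutions $x$, $y$, and there is an identity element $1$ with $1\cdot x = x\cdot 1 = x$); $a\cdot(b+c)=a\cdot b+a\cdot c$ for all $a,b,c\in Q$; $0\cdot x=0$ for all $x\in Q$; and for all $a,b,c\in Q$ with $a\neq b$ the equation $a\cdot x=b\cdot x+c$ has exactly one solution $x$. For $A\subset Q$, $A+A=\{a+b: a,b\in A\}$ and $A\cdot A=\{a\cdot b: a,b\in A\}$. -}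

module Defs where

open import Level using (Level; suc; _⊔_)
open import Data.Nat using (ℕ)
open import Data.Bool using (Bool; true; false; if_then_else_; _∧_; _∨_)
open import Data.Fin using (Fin)
import Data.Fin as Fin
open import Data.List using (List; map; allFin)
open import Data.Nat.ListAction using (sum)
open import Data.Bool.ListAction using (any)
open import Data.Product using (Σ; _×_; _,_)
open import Relation.Binary.PropositionalEquality using (_≡_; _≢_; cong; sym; trans)
open import Relation.Nullary using (yes; no; Dec)
open import Relation.Nullary.Decidable using (⌊_⌋)
open import Relation.Binary.Definitions using (DecidableEquality)
open import Algebra.Structures using (IsGroup)
open import Function.Bundles using (_↔_; Inverse)

ExactlyOne : ∀ {a p} {A : Set a} → (A → Set p) → Set (a ⊔ p)
ExactlyOne {A = A} P = Σ A λ x → P x × (∀ y → P y → y ≡ x)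

record Quasifield (ℓ : Level) : Set (suc ℓ) where
  infixl 6 _+_
  infixl 7 _·_
  field
    Carrier : Set ℓ
    _+_     : Carrier → Carrier → Carrier
    _·_     : Carrier → Carrier → Carrier
    0#      : Carrier
    -_      : Carrier → Carrier
    1#      : Carrier
    +-isGroup : IsGroup _≡_ _+_ 0# -_
    1≢0       : 1# ≢ 0#
    ·-closed  : ∀ a b → a ≢ 0# → b ≢ 0# → a · b ≢ 0#
    ·-identityˡ : ∀ x → x ≢ 0# → 1# · x ≡ x
    ·-identityʳ : ∀ x → x ≢ 0# → x · 1# ≡ x
    ·-leftDiv  : ∀ a b → a ≢ 0# → b ≢ 0# → ExactlyOne (λ x → x ≢ 0# × a · x ≡ b)
    ·-rightDiv : ∀ a b → a ≢ 0# → b ≢ 0# → ExactlyOne (λ y → y ≢ 0# × y · a ≡ b)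
    distribˡ  : ∀ a b c → a · (b + c) ≡ a · b + a · c
    zeroˡ     : ∀ x → 0# · x ≡ 0#
    planar    : ∀ a b c → a ≢ b → ExactlyOne (λ x → a · x ≡ b · x + c)

record FiniteQuasifield (ℓ : Level) (q : ℕ) : Set (suc ℓ) where
  field
    quasifield : Quasifield ℓ
  open Quasifield quasifield public
  field
    enum : Fin q ↔ Carrier

  open Inverse enum using (to; from; strictlyInverseˡ)

  _≟_ : DecidableEquality Carrier
  x ≟ y with from x Fin.≟ from y
  ... | yes p = yes (trans (sym (strictlyInverseˡ x)) (trans (cong to p) (strictlyInverseˡ y)))
  ... | no ¬p = no (λ e → ¬p (cong from e))

  elements : List Carrier
  elements = map to (allFin q)

  -- subsets of Q (decidable, as every subset of a finite set is)
  Subset : Set ℓ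
  Subset = Carrier → Bool

  ∣_∣ : Subset → ℕ
  ∣ S ∣ = sum (map (λ x → if S x then 1 else 0) elements)

  sumset : Subset → Subset
  sumset A x = any (λ a → any (λ b → A a ∧ A b ∧ ⌊ x ≟ (a + b) ⌋) elements) elements

  prodset : Subset → Subset
  prodset A x = any (λ a → any (λ b → A a ∧ A b ∧ ⌊ x ≟ (a · b) ⌋) elements) elements

-- Let S = A + A, T = A · A, m = |S|, n = |T|, and for c ≠ 0 and b let r(c, b) be the number of
-- points of S × T on the "line" {(s, c · (−b + s))}.  Left and right multiplication by nonzero
-- elements and translations permute Q, so the first two moments of r over the q(q − 1) lines can
-- be computed exactly: ∑ (q r − m n)² = q m n (q − m)(q − n) ≤ q³ m n.  For c, b ∈ A the line
-- contains the |A| points (b + a, c · a), a ∈ A, so on these |A|² lines q r − m n ≥ q |A| − m n,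
-- whence |A|² (q |A| − m n)² ≤ q³ m n; when q |A| < m n the truncated difference in the statement
-- is 0.

module Submission where

open import Level using (Level)
open import Function.Base using (_∘_; id)
open import Function.Bundles using (_↔_; Inverse; mk↔ₛ′; Equivalence)
open import Function.Construct.Composition using (_↔-∘_)
open import Function.Construct.Symmetry using (↔-sym)
open import Data.Bool using (Bool; true; false; if_then_else_; not; _∧_)
open import Data.Nat as ℕ using (ℕ; zero; suc)
open import Data.Fin as Fin using (Fin; punchIn)
open import Data.Fin.Properties using (punchInᵢ≢i)
open import Data.Integer using (ℤ)
import Data.Integer as ℤ
import Data.Integer.Properties as ℤₚ
open import Data.Integer.Tactic.RingSolver using (solve-∀)
import Data.List as List using (map; allFin; tabulate)
import Data.List.Properties as Listₚ
import Data.Nat.ListAction as List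
open import Data.Product using (Σ; _,_; proj₁; proj₂)
open import Data.Bool.Properties using (T-≡)
open import Data.Bool.ListAction using (any)
open import Data.List.Membership.Propositional using (_∈_; lose)
open import Data.List.Membership.Propositional.Properties using (∈-map⁺; ∈-allFin)
open import Data.List.Relation.Unary.Any.Properties using (any⁺)
open import Data.Empty using (⊥-elim)
open import Relation.Nullary using (yes; no)
open import Relation.Nullary.Decidable using (⌊_⌋; fromWitness)
open import Relation.Binary.Definitions using (DecidableEquality)
open import Relation.Binary.PropositionalEquality
open import Algebra.Bundles using (Group)
import Algebra.Properties.Group as GroupProperties
import Algebra.Properties.Loop as LoopProperties
open import Defs

module IntegerOrder where

  open import Data.Integer using (+_; -[1+_]; 0ℤ; _*_; _≤_; +≤+)

  0≤i*j : ∀ {i j} → 0ℤ ≤ i → 0ℤ ≤ j → 0ℤ ≤ i * j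
  0≤i*j (+≤+ {n = a} _) (+≤+ {n = b} _) = subst (0ℤ ≤_) (ℤₚ.pos-* a b) (+≤+ ℕ.z≤n)

  0≤i*i : ∀ i → 0ℤ ≤ i * i
  0≤i*i (+ a)      = 0≤i*j {+ a} {+ a} (+≤+ ℕ.z≤n) (+≤+ ℕ.z≤n)
  0≤i*i -[1+ a ]   = +≤+ ℕ.z≤n

  *-mono-≤-nonNeg : ∀ {i j k l} → 0ℤ ≤ i → 0ℤ ≤ k → i ≤ j → k ≤ l → i * k ≤ j * l
  *-mono-≤-nonNeg {i} {j} {k} {l} 0≤i 0≤k i≤j k≤l = ℤₚ.≤-trans
    (ℤₚ.*-monoˡ-≤-nonNeg i ⦃ ℤ.nonNegative 0≤i ⦄ k≤l)
    (ℤₚ.*-monoʳ-≤-nonNeg l ⦃ ℤ.nonNegative (ℤₚ.≤-trans 0≤k k≤l) ⦄ i≤j)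

module FiniteSum {a} {X : Set a} {q : ℕ} (enum : Fin q ↔ X) where

  open import Data.Integer using (+_; 0ℤ; 1ℤ; _+_; _*_; _≤_)
  open Inverse enum using (to; from; strictlyInverseˡ; strictlyInverseʳ)
  open import Algebra.Properties.Semiring.Sum ℤₚ.+-*-semiring
    using (sum; sum-cong-≗; sum-remove; sum-permute; sum-replicate-zero; ∑-distrib-+; *-distribˡ-sum)
    renaming (∑-comm to sum-comm)

  infixr 5 ∑
  syntax ∑ (λ x → e) = ∑[ x ] e

  -- Abstract, so that ∑ is rigid for unification and summands can be inferred.
  abstract

    ∑ : (X → ℤ) → ℤ
    ∑ f = sum (f ∘ to)

    ∑-cong : ∀ {f g : X → ℤ} → (∀ x → f x ≡ g x) → ∑ f ≡ ∑ g
    ∑-cong f≗g = sum-cong-≗ (f≗g ∘ to)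

    ∑-+ : ∀ (f g : X → ℤ) → ∑[ x ] (f x + g x) ≡ ∑ f + ∑ g
    ∑-+ f g = ∑-distrib-+ (f ∘ to) (g ∘ to)

    ∑-*ˡ : ∀ c (f : X → ℤ) → ∑[ x ] (c * f x) ≡ c * ∑ f
    ∑-*ˡ c f = sym (*-distribˡ-sum c (f ∘ to))

    ∑-*ʳ : ∀ c (f : X → ℤ) → ∑[ x ] (f x * c) ≡ ∑ f * c
    ∑-*ʳ c f = begin
      ∑[ x ] (f x * c) ≡⟨ ∑-cong (λ x → ℤₚ.*-comm (f x) c) ⟩
      ∑[ x ] (c * f x) ≡⟨ ∑-*ˡ c f ⟩
      c * ∑ f          ≡⟨ ℤₚ.*-comm c (∑ f) ⟩
      ∑ f * c          ∎
      where open ≡-Reasoning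

    ∑-linear : ∀ α β (f g : X → ℤ) → ∑[ x ] (α * f x + β * g x) ≡ α * ∑ f + β * ∑ g
    ∑-linear α β f g = trans (∑-+ (λ x → α * f x) (λ x → β * g x)) (cong₂ _+_ (∑-*ˡ α f) (∑-*ˡ β g))

    ∑-linear₃ : ∀ α β γ (f g h : X → ℤ) →
      ∑[ x ] (α * f x + β * g x + γ * h x) ≡ α * ∑ f + β * ∑ g + γ * ∑ h
    ∑-linear₃ α β γ f g h =
      trans (∑-+ (λ x → α * f x + β * g x) (λ x → γ * h x)) (cong₂ _+_ (∑-linear α β f g) (∑-*ˡ γ h))

    ∑-comm : ∀ (f : X → X → ℤ) → ∑[ x ] ∑[ y ] f x y ≡ ∑[ y ] ∑[ x ] f x y
    ∑-comm f = sum-comm (λ i j → f (to i) (to j))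

    ∑-const : ∀ c → ∑[ x ] c ≡ + q * c
    ∑-const c = go q
      where
      go : ∀ n → sum {n} (λ _ → c) ≡ + n * c
      go zero    = sym (ℤₚ.*-zeroˡ c)
      go (suc n) = begin
        c + sum {n} (λ _ → c) ≡⟨ cong₂ _+_ (sym (ℤₚ.*-identityˡ c)) (go n) ⟩
        1ℤ * c + + n * c      ≡⟨ sym (ℤₚ.*-distribʳ-+ c 1ℤ (+ n)) ⟩
        (1ℤ + + n) * c        ∎
        where open ≡-Reasoning

    ∑-mono-≤ : ∀ {f g : X → ℤ} → (∀ x → f x ≤ g x) → ∑ f ≤ ∑ g
    ∑-mono-≤ f≤g = go (f≤g ∘ to)
      where
      go : ∀ {n} {u v : Fin n → ℤ} → (∀ i → u i ≤ v i) → sum u ≤ sum v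
      go {zero}  _   = ℤₚ.≤-refl
      go {suc n} u≤v = ℤₚ.+-mono-≤ (u≤v Fin.zero) (go (u≤v ∘ Fin.suc))

    ∑-*-∑ : ∀ (f g : X → ℤ) → ∑ f * ∑ g ≡ ∑[ x ] ∑[ y ] f x * g y
    ∑-*-∑ f g = trans (sym (∑-*ʳ (∑ g) f)) (∑-cong (λ x → sym (∑-*ˡ (f x) g)))

    ∑-nonneg : ∀ {f : X → ℤ} → (∀ x → 0ℤ ≤ f x) → 0ℤ ≤ ∑ f
    ∑-nonneg {f} 0≤f = subst (_≤ ∑ f) (trans (∑-const 0ℤ) (ℤₚ.*-zeroʳ (+ q))) (∑-mono-≤ 0≤f)

    ∑-*-comm : ∀ (w a : X → ℤ) (B : X → X → ℤ) →
      ∑[ x ] w x * (∑[ y ] a y * B x y) ≡ ∑[ y ] a y * (∑[ x ] w x * B x y)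
    ∑-*-comm w a B = begin
      ∑[ x ] w x * (∑[ y ] a y * B x y)  ≡⟨ ∑-cong (λ x → sym (∑-*ˡ (w x) (λ y → a y * B x y))) ⟩
      ∑[ x ] ∑[ y ] w x * (a y * B x y)  ≡⟨ ∑-cong (λ x → ∑-cong (λ y → swap (w x) (a y) (B x y))) ⟩
      ∑[ x ] ∑[ y ] a y * (w x * B x y)  ≡⟨ ∑-comm (λ x y → a y * (w x * B x y)) ⟩
      ∑[ y ] ∑[ x ] a y * (w x * B x y)  ≡⟨ ∑-cong (λ y → ∑-*ˡ (a y) (λ x → w x * B x y)) ⟩
      ∑[ y ] a y * (∑[ x ] w x * B x y)  ∎
      where
      open ≡-Reasoning
      swap : ∀ u v z → u * (v * z) ≡ v * (u * z)
      swap = solve-∀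

    ∑-reindex : ∀ (π : X ↔ X) (f : X → ℤ) → ∑ (f ∘ Inverse.to π) ≡ ∑ f
    ∑-reindex π f = sym (begin
      ∑ f                                         ≡⟨ sum-permute (f ∘ to) ρ ⟩
      sum {q} (f ∘ to ∘ from ∘ Inverse.to π ∘ to) ≡⟨ sum-cong-≗ {q} (cong f ∘ strictlyInverseˡ ∘ Inverse.to π ∘ to) ⟩
      ∑ (f ∘ Inverse.to π)                        ∎)
      where
      open ≡-Reasoning
      ρ : Fin q ↔ Fin q
      ρ = ↔-sym enum ↔-∘ (π ↔-∘ enum)

    ∑-enumeration : ∀ (g : X → ℕ) → + List.sum (List.map g (List.map to (List.allFin q))) ≡ ∑[ x ] + g x
    ∑-enumeration g = trans (cong (+_ ∘ List.sum) enumerated) (go (g ∘ to))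
      where
      enumerated : List.map g (List.map to (List.allFin q)) ≡ List.tabulate (g ∘ to)
      enumerated = trans (cong (List.map g) (Listₚ.map-tabulate id to)) (Listₚ.map-tabulate to g)
      go : ∀ {n} (h : Fin n → ℕ) → + List.sum (List.tabulate h) ≡ sum (λ i → + h i)
      go {zero}  h = refl
      go {suc n} h = trans (ℤₚ.pos-+ (h Fin.zero) _) (cong (_+_ (+ h Fin.zero)) (go (h ∘ Fin.suc)))

    ∑-supported : ∀ (f : X → ℤ) x₀ → (∀ x → x ≢ x₀ → f x ≡ 0ℤ) → ∑ f ≡ f x₀
    ∑-supported f x₀ vanish = trans (go (f ∘ to) (from x₀) vanish′) (cong f (strictlyInverseˡ x₀))
      where
      vanish′ : ∀ j → j ≢ from x₀ → f (to j) ≡ 0ℤ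
      vanish′ j j≢ = vanish (to j) (λ e → j≢ (trans (sym (strictlyInverseʳ j)) (cong from e)))
      go : ∀ {n} (t : Fin n → ℤ) i → (∀ j → j ≢ i → t j ≡ 0ℤ) → sum t ≡ t i
      go {suc n} t i t≗0 = begin
        sum t                       ≡⟨ sum-remove t ⟩
        t i + sum (t ∘ punchIn i)   ≡⟨ cong (_+_ (t i)) (sum-cong-≗ (λ j → t≗0 _ (punchInᵢ≢i i j))) ⟩
        t i + sum {n} (λ _ → 0ℤ)    ≡⟨ cong (_+_ (t i)) (sum-replicate-zero n) ⟩
        t i + 0ℤ                    ≡⟨ ℤₚ.+-identityʳ (t i) ⟩
        t i                         ∎
        where open ≡-Reasoning

module QuasifieldProperties {ℓ} (Q : Quasifield ℓ) (_≟_ : DecidableEquality (Quasifield.Carrier Q)) where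

  open Quasifield Q renaming (_+_ to _⊕_; -_ to ⊖_)

  +-group : Group ℓ ℓ
  +-group = record { isGroup = +-isGroup }

  open Group +-group using () renaming (identityˡ to ⊕-identityˡ; identityʳ to ⊕-identityʳ)
  open GroupProperties +-group
    using (loop; ⁻¹-involutive; \\-leftDividesˡ; \\-leftDividesʳ; //-rightDividesˡ; //-rightDividesʳ)
  open LoopProperties loop using (identityʳ-unique)

  ·-zeroʳ : ∀ c → c · 0# ≡ 0#
  ·-zeroʳ c = identityʳ-unique (c · 0#) (c · 0#) (begin
    c · 0# ⊕ c · 0#  ≡⟨ sym (distribˡ c 0# 0#) ⟩
    c · (0# ⊕ 0#)    ≡⟨ cong (c ·_) (⊕-identityˡ 0#) ⟩
    c · 0#           ∎)
    where open ≡-Reasoning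

  ·-cancelˡ : ∀ {c} → c ≢ 0# → ∀ {x y} → c · x ≡ c · y → x ≡ y
  ·-cancelˡ {c} c≢0 {x} {y} cx≡cy with (⊖ y ⊕ x) ≟ 0#
  ... | yes d≡0 = begin
    x              ≡⟨ sym (\\-leftDividesˡ y x) ⟩
    y ⊕ (⊖ y ⊕ x)  ≡⟨ cong (y ⊕_) d≡0 ⟩
    y ⊕ 0#         ≡⟨ ⊕-identityʳ y ⟩
    y              ∎
    where open ≡-Reasoning
  ... | no d≢0 = ⊥-elim (·-closed c (⊖ y ⊕ x) c≢0 d≢0 (identityʳ-unique (c · y) _ (begin
    c · y ⊕ c · (⊖ y ⊕ x)  ≡⟨ sym (distribˡ c y (⊖ y ⊕ x)) ⟩
    c · (y ⊕ (⊖ y ⊕ x))    ≡⟨ cong (c ·_) (\\-leftDividesˡ y x) ⟩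
    c · x                  ≡⟨ cx≡cy ⟩
    c · y                  ∎)))
    where open ≡-Reasoning

  ·-cancelʳ : ∀ {k} → k ≢ 0# → ∀ {x y} → x · k ≡ y · k → x ≡ y
  ·-cancelʳ {k} k≢0 {x} {y} xk≡yk with x ≟ 0# | y ≟ 0#
  ... | yes x≡0 | yes y≡0 = trans x≡0 (sym y≡0)
  ... | yes x≡0 | no y≢0  = ⊥-elim (·-closed y k y≢0 k≢0 (trans (sym xk≡yk) (trans (cong (_· k) x≡0) (zeroˡ k))))
  ... | no x≢0  | yes y≡0 = ⊥-elim (·-closed x k x≢0 k≢0 (trans xk≡yk (trans (cong (_· k) y≡0) (zeroˡ k))))
  ... | no x≢0  | no y≢0  with ·-rightDiv k (y · k) k≢0 (·-closed y k y≢0 k≢0)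
  ...   | _ , _ , unique = trans (unique x (x≢0 , xk≡yk)) (sym (unique y (y≢0 , refl)))

  leftTranslation : Carrier → Carrier ↔ Carrier
  leftTranslation v = mk↔ₛ′ (v ⊕_) (⊖ v ⊕_) (\\-leftDividesˡ v) (\\-leftDividesʳ v)

  rightTranslation : Carrier → Carrier ↔ Carrier
  rightTranslation s = mk↔ₛ′ (_⊕ s) (_⊕ ⊖ s) (//-rightDividesˡ s) (//-rightDividesʳ s)

  negation : Carrier ↔ Carrier
  negation = mk↔ₛ′ ⊖_ ⊖_ ⁻¹-involutive ⁻¹-involutive

  leftMultiplication : ∀ {c} → c ≢ 0# → Carrier ↔ Carrier
  leftMultiplication {c} c≢0 =
    mk↔ₛ′ (c ·_) divide divide-correct (λ x → ·-cancelˡ c≢0 (divide-correct (c · x)))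
    where
    quotient : ∀ w → Σ Carrier (λ x → c · x ≡ w)
    quotient w with w ≟ 0#
    ... | yes w≡0 = 0# , trans (·-zeroʳ c) (sym w≡0)
    ... | no w≢0  with ·-leftDiv c w c≢0 w≢0
    ...   | x , (_ , cx≡w) , _ = x , cx≡w
    divide : Carrier → Carrier
    divide w = proj₁ (quotient w)
    divide-correct : ∀ w → c · divide w ≡ w
    divide-correct w = proj₂ (quotient w)

  rightMultiplication : ∀ {k} → k ≢ 0# → Carrier ↔ Carrier
  rightMultiplication {k} k≢0 =
    mk↔ₛ′ (_· k) divide divide-correct (λ x → ·-cancelʳ k≢0 (divide-correct (x · k)))
    where
    quotient : ∀ t → Σ Carrier (λ x → x · k ≡ t)
    quotient t with t ≟ 0#
    ... | yes t≡0 = 0# , trans (zeroˡ k) (sym t≡0)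
    ... | no t≢0  with ·-rightDiv k t k≢0 t≢0
    ...   | x , (_ , xk≡t) , _ = x , xk≡t
    divide : Carrier → Carrier
    divide t = proj₁ (quotient t)
    divide-correct : ∀ t → divide t · k ≡ t
    divide-correct t = proj₂ (quotient t)

module LineIncidences {ℓ} {q} (Q : FiniteQuasifield ℓ q) where

  open import Data.Integer using (+_; 0ℤ; 1ℤ; _+_; _-_; _*_; -_; _≤_; +≤+)
  open FiniteQuasifield Q renaming (_+_ to _⊕_; -_ to ⊖_)
  open FiniteSum enum
  open QuasifieldProperties quasifield _≟_
  open IntegerOrder
  open Group +-group using () renaming (assoc to ⊕-assoc; identityʳ to ⊕-identityʳ; inverseˡ to ⊕-inverseˡ)
  open GroupProperties +-group using (\\-leftDividesˡ)

  𝟙 : Bool → ℤ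
  𝟙 b = + (if b then 1 else 0)

  χ : Subset → Carrier → ℤ
  χ S x = 𝟙 (S x)

  δ : Carrier → Carrier → ℤ
  δ x y = 𝟙 ⌊ y ≟ x ⌋

  nonzero : Subset
  nonzero x = not ⌊ x ≟ 0# ⌋

  0≤χ : ∀ S x → 0ℤ ≤ χ S x
  0≤χ S x with S x
  ... | true  = +≤+ ℕ.z≤n
  ... | false = +≤+ ℕ.z≤n

  χ≤1 : ∀ S x → χ S x ≤ 1ℤ
  χ≤1 S x with S x
  ... | true  = ℤₚ.≤-refl
  ... | false = +≤+ ℕ.z≤n

  ∣_∣ᶻ : Subset → ℤ
  ∣ S ∣ᶻ = ∑ (χ S)

  0≤∣∣ᶻ : ∀ S → 0ℤ ≤ ∣ S ∣ᶻ
  0≤∣∣ᶻ S = ∑-nonneg (0≤χ S)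

  ∣∣ᶻ≤q : ∀ S → ∣ S ∣ᶻ ≤ + q
  ∣∣ᶻ≤q S = ℤₚ.≤-trans (∑-mono-≤ (χ≤1 S))
                       (ℤₚ.≤-reflexive (trans (∑-const 1ℤ) (ℤₚ.*-identityʳ (+ q))))

  ∣∣≡∣∣ᶻ : ∀ S → + ∣ S ∣ ≡ ∣ S ∣ᶻ
  ∣∣≡∣∣ᶻ S = ∑-enumeration (λ x → if S x then 1 else 0)

  ∑-χ-affine : ∀ S α β → ∑[ x ] χ S x * (α + β * χ S x) ≡ (α + β) * ∣ S ∣ᶻ
  ∑-χ-affine S α β = trans (∑-cong pointwise) (∑-*ˡ (α + β) (χ S))
    where
    pointwise : ∀ x → χ S x * (α + β * χ S x) ≡ (α + β) * χ S x
    pointwise x with S x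
    ... | true  = at-one α β
      where
      at-one : ∀ a b → 1ℤ * (a + b * 1ℤ) ≡ (a + b) * 1ℤ
      at-one = solve-∀
    ... | false = sym (ℤₚ.*-zeroʳ (α + β))

  ∑-δ : ∀ x (f : Carrier → ℤ) → ∑[ y ] δ x y * f y ≡ f x
  ∑-δ x f = trans (∑-supported (λ y → δ x y * f y) x vanish) (δ-refl)
    where
    vanish : ∀ y → y ≢ x → δ x y * f y ≡ 0ℤ
    vanish y y≢x with y ≟ x
    ... | yes y≡x = ⊥-elim (y≢x y≡x)
    ... | no _    = refl
    δ-refl : δ x x * f x ≡ f x
    δ-refl with x ≟ x
    ... | yes _   = ℤₚ.*-identityˡ (f x)
    ... | no x≢x  = ⊥-elim (x≢x refl)

  δ-difference : ∀ s s′ → δ 0# (⊖ s ⊕ s′) ≡ δ s s′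
  δ-difference s s′ with (⊖ s ⊕ s′) ≟ 0# | s′ ≟ s
  ... | yes _   | yes _    = refl
  ... | no  _   | no  _    = refl
  ... | yes d≡0 | no s′≢s = ⊥-elim (s′≢s (begin
    s′              ≡⟨ sym (\\-leftDividesˡ s s′) ⟩
    s ⊕ (⊖ s ⊕ s′)  ≡⟨ cong (s ⊕_) d≡0 ⟩
    s ⊕ 0#          ≡⟨ ⊕-identityʳ s ⟩
    s               ∎))
    where open ≡-Reasoning
  ... | no d≢0  | yes s′≡s = ⊥-elim (d≢0 (trans (cong (⊖ s ⊕_) s′≡s) (⊕-inverseˡ s)))

  nonzero-guard : ∀ c {x y} → (c ≢ 0# → x ≡ y) → χ nonzero c * x ≡ χ nonzero c * y
  nonzero-guard c x≡y with c ≟ 0#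
  ... | yes _   = refl
  ... | no c≢0  = cong (1ℤ *_) (x≡y c≢0)

  χ-nonzero : ∀ {c} → c ≢ 0# → χ nonzero c ≡ 1ℤ
  χ-nonzero {c} c≢0 with c ≟ 0#
  ... | yes c≡0 = ⊥-elim (c≢0 c≡0)
  ... | no _    = refl

  ∑-nonzero : ∀ (f : Carrier → ℤ) → ∑[ c ] χ nonzero c * f c ≡ ∑ f - f 0#
  ∑-nonzero f = begin
    ∑ g                        ≡⟨ x≡x+y-y (∑ g) (f 0#) ⟩
    ∑ g + f 0# - f 0#          ≡⟨ cong (λ z → ∑ g + z - f 0#) (∑-δ 0# f) ⟨
    ∑ g + ∑ h - f 0#           ≡⟨ cong (_- f 0#) (∑-+ g h) ⟨
    (∑[ c ] g c + h c) - f 0#  ≡⟨ cong (_- f 0#) (∑-cong split) ⟩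
    ∑ f - f 0#                 ∎
    where
    open ≡-Reasoning
    g h : Carrier → ℤ
    g c = χ nonzero c * f c
    h c = δ 0# c * f c
    x≡x+y-y : ∀ x y → x ≡ x + y - y
    x≡x+y-y = solve-∀
    split : ∀ c → g c + h c ≡ f c
    split c with c ≟ 0#
    ... | yes _ = trans (ℤₚ.+-identityˡ (1ℤ * f c)) (ℤₚ.*-identityˡ (f c))
    ... | no _  = trans (ℤₚ.+-identityʳ (1ℤ * f c)) (ℤₚ.*-identityˡ (f c))

  ∑-nonzero-const : ∀ x → ∑[ c ] χ nonzero c * x ≡ (+ q - 1ℤ) * x
  ∑-nonzero-const x = trans (∑-nonzero (λ _ → x)) (trans (cong (_- x) (∑-const x)) (factor (+ q) x))
    where
    factor : ∀ k x → k * x - x ≡ (k - 1ℤ) * x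
    factor = solve-∀

  ∑-line : ∀ {c} → c ≢ 0# → ∀ s (g : Carrier → ℤ) → ∑[ b ] g (c · (⊖ b ⊕ s)) ≡ ∑ g
  ∑-line c≢0 s g = trans (∑-reindex (rightTranslation s ↔-∘ negation) (g ∘ (_ ·_)))
                         (∑-reindex (leftMultiplication c≢0) g)

  line-shift : ∀ c b s s′ → c · (⊖ b ⊕ s′) ≡ c · (⊖ b ⊕ s) ⊕ c · (⊖ s ⊕ s′)
  line-shift c b s s′ = begin
    c · (⊖ b ⊕ s′)                ≡⟨ cong (λ z → c · (⊖ b ⊕ z)) (\\-leftDividesˡ s s′) ⟨
    c · (⊖ b ⊕ (s ⊕ (⊖ s ⊕ s′)))  ≡⟨ cong (c ·_) (⊕-assoc (⊖ b) s (⊖ s ⊕ s′)) ⟨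
    c · (⊖ b ⊕ s ⊕ (⊖ s ⊕ s′))    ≡⟨ distribˡ c (⊖ b ⊕ s) (⊖ s ⊕ s′) ⟩
    c · (⊖ b ⊕ s) ⊕ c · (⊖ s ⊕ s′) ∎
    where open ≡-Reasoning

  ∑ᴸ : (Carrier → Carrier → ℤ) → ℤ
  ∑ᴸ F = ∑[ c ] χ nonzero c * (∑[ b ] F c b)

  ∑ᴸ-linear₃ : ∀ α β γ (F G H : Carrier → Carrier → ℤ) →
    ∑ᴸ (λ c b → α * F c b + β * G c b + γ * H c b) ≡ α * ∑ᴸ F + β * ∑ᴸ G + γ * ∑ᴸ H
  ∑ᴸ-linear₃ α β γ F G H = begin
    ∑[ c ] χ nonzero c * (∑[ b ] (α * F c b + β * G c b + γ * H c b))
      ≡⟨ ∑-cong (λ c → trans (cong (χ nonzero c *_) (∑-linear₃ α β γ (F c) (G c) (H c)))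
                             (distribute (χ nonzero c) α β γ _ _ _)) ⟩
    ∑[ c ] (α * (χ nonzero c * ∑ (F c)) + β * (χ nonzero c * ∑ (G c)) + γ * (χ nonzero c * ∑ (H c)))
      ≡⟨ ∑-linear₃ α β γ _ _ _ ⟩
    α * ∑ᴸ F + β * ∑ᴸ G + γ * ∑ᴸ H
      ∎
    where
    open ≡-Reasoning
    distribute : ∀ w α β γ x y z → w * (α * x + β * y + γ * z) ≡ α * (w * x) + β * (w * y) + γ * (w * z)
    distribute = solve-∀

  module _ (S T : Subset) where

    private
      m n : ℤ
      m = ∣ S ∣ᶻ
      n = ∣ T ∣ᶻ

    incidences : Carrier → Carrier → ℤ
    incidences c b = ∑[ s ] χ S s * χ T (c · (⊖ b ⊕ s))

    shiftOverlap : Carrier → ℤ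
    shiftOverlap w = ∑[ v ] χ T v * χ T (v ⊕ w)

    ∑-incidences : ∀ {c} → c ≢ 0# → ∑[ b ] incidences c b ≡ m * n
    ∑-incidences {c} c≢0 = begin
      ∑[ b ] ∑[ s ] χ S s * χ T (c · (⊖ b ⊕ s))     ≡⟨ ∑-comm _ ⟩
      ∑[ s ] ∑[ b ] χ S s * χ T (c · (⊖ b ⊕ s))     ≡⟨ ∑-cong (λ s → ∑-*ˡ (χ S s) _) ⟩
      ∑[ s ] χ S s * (∑[ b ] χ T (c · (⊖ b ⊕ s)))   ≡⟨ ∑-cong (λ s → cong (χ S s *_) (∑-line c≢0 s (χ T))) ⟩
      ∑[ s ] χ S s * n                              ≡⟨ ∑-*ʳ n (χ S) ⟩
      m * n                                         ∎
      where open ≡-Reasoning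

    ∑-incidences² : ∀ {c} → c ≢ 0# →
      ∑[ b ] incidences c b * incidences c b ≡ ∑[ s ] χ S s * (∑[ s′ ] χ S s′ * shiftOverlap (c · (⊖ s ⊕ s′)))
    ∑-incidences² {c} c≢0 = begin
      ∑[ b ] incidences c b * incidences c b       ≡⟨ ∑-cong (λ b → ∑-*-∑ (point b) (point b)) ⟩
      ∑[ b ] ∑[ s ] ∑[ s′ ] point b s * point b s′ ≡⟨ ∑-comm _ ⟩
      ∑[ s ] ∑[ b ] ∑[ s′ ] point b s * point b s′ ≡⟨ ∑-cong (λ s → ∑-comm _) ⟩
      ∑[ s ] ∑[ s′ ] ∑[ b ] point b s * point b s′ ≡⟨ ∑-cong (λ s → ∑-cong (pair-count s)) ⟩
      ∑[ s ] ∑[ s′ ] χ S s * (χ S s′ * shiftOverlap (c · (⊖ s ⊕ s′)))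
        ≡⟨ ∑-cong (λ s → ∑-*ˡ (χ S s) _) ⟩
      ∑[ s ] χ S s * (∑[ s′ ] χ S s′ * shiftOverlap (c · (⊖ s ⊕ s′)))
        ∎
      where
      open ≡-Reasoning
      point : Carrier → Carrier → ℤ
      point b s = χ S s * χ T (c · (⊖ b ⊕ s))
      regroup : ∀ x y z w → x * y * (z * w) ≡ x * (z * (y * w))
      regroup = solve-∀
      pair-count : ∀ s s′ → ∑[ b ] point b s * point b s′ ≡ χ S s * (χ S s′ * shiftOverlap (c · (⊖ s ⊕ s′)))
      pair-count s s′ = begin
        ∑[ b ] point b s * point b s′
          ≡⟨ ∑-cong (λ b → regroup (χ S s) (χ T (c · (⊖ b ⊕ s))) (χ S s′) (χ T (c · (⊖ b ⊕ s′)))) ⟩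
        ∑[ b ] χ S s * (χ S s′ * (χ T (c · (⊖ b ⊕ s)) * χ T (c · (⊖ b ⊕ s′))))
          ≡⟨ trans (∑-*ˡ (χ S s) _) (cong (χ S s *_) (∑-*ˡ (χ S s′) _)) ⟩
        χ S s * (χ S s′ * (∑[ b ] χ T (c · (⊖ b ⊕ s)) * χ T (c · (⊖ b ⊕ s′))))
          ≡⟨ cong (λ z → χ S s * (χ S s′ * z))
                  (∑-cong (λ b → cong (λ z → χ T (c · (⊖ b ⊕ s)) * χ T z) (line-shift c b s s′))) ⟩
        χ S s * (χ S s′ * (∑[ b ] χ T (c · (⊖ b ⊕ s)) * χ T (c · (⊖ b ⊕ s) ⊕ c · (⊖ s ⊕ s′))))
          ≡⟨ cong (λ z → χ S s * (χ S s′ * z)) (∑-line c≢0 s (λ v → χ T v * χ T (v ⊕ c · (⊖ s ⊕ s′))))  ⟩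
        χ S s * (χ S s′ * shiftOverlap (c · (⊖ s ⊕ s′)))
          ∎

    ∑-shiftOverlap : ∀ k → ∑[ c ] χ nonzero c * shiftOverlap (c · k) ≡ n * n - n + (+ q * n - n * n) * δ 0# k
    ∑-shiftOverlap k = begin
      ∑[ c ] χ nonzero c * shiftOverlap (c · k)
        ≡⟨ ∑-*-comm (χ nonzero) (χ T) (λ c v → χ T (v ⊕ c · k)) ⟩
      ∑[ v ] χ T v * (∑[ c ] χ nonzero c * χ T (v ⊕ c · k))
        ≡⟨ ∑-cong (λ v → cong (χ T v *_) (trans (∑-nonzero _)
                                                (cong (λ z → (∑[ c ] χ T (v ⊕ c · k)) - χ T z) (v⊕0·k≡v v)))) ⟩
      ∑[ v ] χ T v * ((∑[ c ] χ T (v ⊕ c · k)) - χ T v)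
        ≡⟨ by-cases ⟩
      n * n - n + (+ q * n - n * n) * δ 0# k
        ∎
      where
      open ≡-Reasoning
      v⊕0·k≡v : ∀ v → v ⊕ 0# · k ≡ v
      v⊕0·k≡v v = trans (cong (v ⊕_) (zeroˡ k)) (⊕-identityʳ v)
      by-cases : ∑[ v ] χ T v * ((∑[ c ] χ T (v ⊕ c · k)) - χ T v) ≡ n * n - n + (+ q * n - n * n) * δ 0# k
      by-cases with k ≟ 0#
      ... | yes refl = begin
        ∑[ v ] χ T v * ((∑[ c ] χ T (v ⊕ c · 0#)) - χ T v)
          ≡⟨ ∑-cong (λ v → cong (λ z → χ T v * (z - χ T v)) (∑-line-zero v)) ⟩
        ∑[ v ] χ T v * (+ q * χ T v - χ T v)
          ≡⟨ ∑-cong (λ v → cong (χ T v *_) (affine (+ q) (χ T v))) ⟩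
        ∑[ v ] χ T v * (0ℤ + (+ q - 1ℤ) * χ T v)
          ≡⟨ ∑-χ-affine T 0ℤ (+ q - 1ℤ) ⟩
        (0ℤ + (+ q - 1ℤ)) * n
          ≡⟨ at-zero (+ q) n ⟩
        n * n - n + (+ q * n - n * n) * 1ℤ
          ∎
        where
        ∑-line-zero : ∀ v → ∑[ c ] χ T (v ⊕ c · 0#) ≡ + q * χ T v
        ∑-line-zero v = trans (∑-cong (λ c → cong (λ z → χ T (v ⊕ z)) (·-zeroʳ c)))
                              (trans (cong (λ z → ∑[ c ] χ T z) (⊕-identityʳ v)) (∑-const (χ T v)))
        affine : ∀ Q x → Q * x - x ≡ 0ℤ + (Q - 1ℤ) * x
        affine = solve-∀
        at-zero : ∀ Q n → (0ℤ + (Q - 1ℤ)) * n ≡ n * n - n + (Q * n - n * n) * 1ℤ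
        at-zero = solve-∀
      ... | no k≢0 = begin
        ∑[ v ] χ T v * ((∑[ c ] χ T (v ⊕ c · k)) - χ T v)
          ≡⟨ ∑-cong (λ v → cong (λ z → χ T v * (z - χ T v)) (∑-line-nonzero v)) ⟩
        ∑[ v ] χ T v * (n - χ T v)
          ≡⟨ ∑-cong (λ v → cong (λ z → χ T v * (n + z)) (ℤₚ.-1*i≡-i (χ T v))) ⟨
        ∑[ v ] χ T v * (n + - 1ℤ * χ T v)
          ≡⟨ ∑-χ-affine T n (- 1ℤ) ⟩
        (n + - 1ℤ) * n
          ≡⟨ away-from-zero (+ q) n ⟩
        n * n - n + (+ q * n - n * n) * 0ℤ
          ∎
        where
        ∑-line-nonzero : ∀ v → ∑[ c ] χ T (v ⊕ c · k) ≡ n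
        ∑-line-nonzero v = trans (∑-reindex (rightMultiplication k≢0) (λ t → χ T (v ⊕ t)))
                                 (∑-reindex (leftTranslation v) (χ T))
        away-from-zero : ∀ Q n → (n + - 1ℤ) * n ≡ n * n - n + (Q * n - n * n) * 0ℤ
        away-from-zero = solve-∀

    ∑ᴸ-incidences : ∑ᴸ incidences ≡ (+ q - 1ℤ) * (m * n)
    ∑ᴸ-incidences = trans (∑-cong (λ c → nonzero-guard c ∑-incidences)) (∑-nonzero-const (m * n))

    ∑ᴸ-incidences² : ∑ᴸ (λ c b → incidences c b * incidences c b) ≡ m * ((n * n - n) * m + (+ q * n - n * n))
    ∑ᴸ-incidences² = begin
      ∑[ c ] χ nonzero c * (∑[ b ] incidences c b * incidences c b)
        ≡⟨ ∑-cong (λ c → nonzero-guard c ∑-incidences²) ⟩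
      ∑[ c ] χ nonzero c * (∑[ s ] χ S s * (∑[ s′ ] χ S s′ * shiftOverlap (c · (⊖ s ⊕ s′))))
        ≡⟨ ∑-*-comm (χ nonzero) (χ S) (λ c s → ∑[ s′ ] χ S s′ * shiftOverlap (c · (⊖ s ⊕ s′))) ⟩
      ∑[ s ] χ S s * (∑[ c ] χ nonzero c * (∑[ s′ ] χ S s′ * shiftOverlap (c · (⊖ s ⊕ s′))))
        ≡⟨ ∑-cong (λ s → cong (χ S s *_) (∑-*-comm (χ nonzero) (χ S) (λ c s′ → shiftOverlap (c · (⊖ s ⊕ s′))))) ⟩
      ∑[ s ] χ S s * (∑[ s′ ] χ S s′ * (∑[ c ] χ nonzero c * shiftOverlap (c · (⊖ s ⊕ s′))))
        ≡⟨ ∑-cong (λ s → cong (χ S s *_) (∑-cong (λ s′ → cong (χ S s′ *_)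
             (trans (∑-shiftOverlap (⊖ s ⊕ s′)) (cong (λ z → α + β * z) (δ-difference s s′)))))) ⟩
      ∑[ s ] χ S s * (∑[ s′ ] χ S s′ * (α + β * δ s s′))
        ≡⟨ ∑-cong (λ s → cong (χ S s *_) (inner s)) ⟩
      ∑[ s ] χ S s * (α * m + β * χ S s)
        ≡⟨ ∑-χ-affine S (α * m) β ⟩
      (α * m + β) * m
        ≡⟨ ℤₚ.*-comm (α * m + β) m ⟩
      m * (α * m + β)
        ∎
      where
      open ≡-Reasoning
      α β : ℤ
      α = n * n - n
      β = + q * n - n * n
      spread : ∀ a b x d → x * (a + b * d) ≡ a * x + b * (d * x)
      spread = solve-∀
      inner : ∀ s → ∑[ s′ ] χ S s′ * (α + β * δ s s′) ≡ α * m + β * χ S s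
      inner s = begin
        ∑[ s′ ] χ S s′ * (α + β * δ s s′)            ≡⟨ ∑-cong (λ s′ → spread α β (χ S s′) (δ s s′)) ⟩
        ∑[ s′ ] (α * χ S s′ + β * (δ s s′ * χ S s′)) ≡⟨ ∑-linear α β (χ S) (λ s′ → δ s s′ * χ S s′) ⟩
        α * m + β * (∑[ s′ ] δ s s′ * χ S s′)        ≡⟨ cong (λ z → α * m + β * z) (∑-δ s (χ S)) ⟩
        α * m + β * χ S s                            ∎

    deviation : Carrier → Carrier → ℤ
    deviation c b = + q * incidences c b - m * n

    line-variance : ∑ᴸ (λ c b → deviation c b * deviation c b) ≡ + q * m * n * (+ q - m) * (+ q - n)
    line-variance = begin
      ∑ᴸ (λ c b → deviation c b * deviation c b)
        ≡⟨ ∑-cong (λ c → cong (χ nonzero c *_) (∑-cong (λ b → expand (+ q) (incidences c b) (m * n)))) ⟩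
      ∑ᴸ (λ c b → + q * + q * (incidences c b * incidences c b) + -2qP * incidences c b + m * n * (m * n) * 1ℤ)
        ≡⟨ ∑ᴸ-linear₃ (+ q * + q) -2qP (m * n * (m * n))
                      (λ c b → incidences c b * incidences c b) incidences (λ _ _ → 1ℤ) ⟩
      + q * + q * ∑ᴸ (λ c b → incidences c b * incidences c b) + -2qP * ∑ᴸ incidences
        + m * n * (m * n) * ∑ᴸ (λ _ _ → 1ℤ)
        ≡⟨ evaluate ∑ᴸ-incidences² ∑ᴸ-incidences ∑ᴸ-one ⟩
      + q * m * n * (+ q - m) * (+ q - n)
        ∎
      where
      open ≡-Reasoning
      -2qP : ℤ
      -2qP = - (+ 2) * + q * (m * n)
      expand : ∀ Q r P → (Q * r - P) * (Q * r - P) ≡ Q * Q * (r * r) + - (+ 2) * Q * P * r + P * P * 1ℤ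
      expand = solve-∀
      ∑ᴸ-one : ∑ᴸ (λ _ _ → 1ℤ) ≡ (+ q - 1ℤ) * (+ q * 1ℤ)
      ∑ᴸ-one = trans (∑-cong (λ c → cong (χ nonzero c *_) (∑-const 1ℤ))) (∑-nonzero-const (+ q * 1ℤ))
      collect : ∀ Q m n →
        Q * Q * (m * ((n * n - n) * m + (Q * n - n * n))) + - (+ 2) * Q * (m * n) * ((Q - 1ℤ) * (m * n))
          + m * n * (m * n) * ((Q - 1ℤ) * (Q * 1ℤ))
        ≡ Q * m * n * (Q - m) * (Q - n)
      collect = solve-∀
      evaluate : ∀ {x y z} →
        x ≡ m * ((n * n - n) * m + (+ q * n - n * n)) →
        y ≡ (+ q - 1ℤ) * (m * n) →
        z ≡ (+ q - 1ℤ) * (+ q * 1ℤ) →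
        + q * + q * x + -2qP * y + m * n * (m * n) * z ≡ + q * m * n * (+ q - m) * (+ q - n)
      evaluate refl refl refl = collect (+ q) m n

    line-variance-≤ : ∑ᴸ (λ c b → deviation c b * deviation c b) ≤ + q * + q * + q * m * n
    line-variance-≤ = begin
      ∑ᴸ (λ c b → deviation c b * deviation c b)  ≡⟨ line-variance ⟩
      + q * m * n * (+ q - m) * (+ q - n)         ≤⟨ ℤₚ.i≤i+j _ slack ⦃ ℤ.nonNegative 0≤slack ⦄ ⟩
      + q * m * n * (+ q - m) * (+ q - n) + slack ≡⟨ complete (+ q) m n ⟩
      + q * + q * + q * m * n                     ∎
      where
      open ℤₚ.≤-Reasoning
      slack : ℤ
      slack = + q * m * n * (+ q * m + n * (+ q - m))
      0≤q : 0ℤ ≤ + q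
      0≤q = +≤+ ℕ.z≤n
      0≤slack : 0ℤ ≤ slack
      0≤slack = 0≤i*j (0≤i*j (0≤i*j 0≤q (0≤∣∣ᶻ S)) (0≤∣∣ᶻ T))
                      (ℤₚ.+-mono-≤ (0≤i*j 0≤q (0≤∣∣ᶻ S)) (0≤i*j (0≤∣∣ᶻ T) (ℤₚ.i≤j⇒0≤j-i (∣∣ᶻ≤q S))))
      complete : ∀ Q m n → Q * m * n * (Q - m) * (Q - n) + Q * m * n * (Q * m + n * (Q - m)) ≡ Q * Q * Q * m * n
      complete = solve-∀

  ∈-elements : ∀ x → x ∈ elements
  ∈-elements x = subst (_∈ elements) (Inverse.strictlyInverseˡ enum x) (∈-map⁺ (Inverse.to enum) (∈-allFin _))

  any-elements : ∀ (p : Carrier → Bool) {x} → p x ≡ true → any p elements ≡ true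
  any-elements p {x} px = Equivalence.to T-≡ (any⁺ p (lose (∈-elements x) (Equivalence.from T-≡ px)))

  ∈-pairset⁺ : ∀ (_∙_ : Carrier → Carrier → Carrier) (A : Subset) {a b} → A a ≡ true → A b ≡ true →
    any (λ a′ → any (λ b′ → A a′ ∧ A b′ ∧ ⌊ (a ∙ b) ≟ (a′ ∙ b′) ⌋) elements) elements ≡ true
  ∈-pairset⁺ _∙_ A {a} {b} Aa Ab = any-elements _ (any-elements _ witness)
    where
    witness : A a ∧ A b ∧ ⌊ (a ∙ b) ≟ (a ∙ b) ⌋ ≡ true
    witness rewrite Aa | Ab = Equivalence.to T-≡ (fromWitness refl)

  module _ (A : Subset) where

    incidences-≥ : ∀ {c b} → A c ≡ true → A b ≡ true → ∣ A ∣ᶻ ≤ incidences (sumset A) (prodset A) c b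
    incidences-≥ {c} {b} Ac Ab = ℤₚ.≤-trans
      (ℤₚ.≤-reflexive (sym (∑-reindex (leftTranslation (⊖ b)) (χ A))))
      (∑-mono-≤ pointwise)
      where
      pointwise : ∀ s → χ A (⊖ b ⊕ s) ≤ χ (sumset A) s * χ (prodset A) (c · (⊖ b ⊕ s))
      pointwise s with A (⊖ b ⊕ s) in Aa
      ... | false = 0≤i*j (0≤χ (sumset A) s) (0≤χ (prodset A) _)
      ... | true rewrite subst (λ z → sumset A z ≡ true) (\\-leftDividesˡ b s) (∈-pairset⁺ _⊕_ A Ab Aa)
                       | ∈-pairset⁺ _·_ A Ac Aa = ℤₚ.≤-refl

    sum-product-bound-∣∣ᶻ : (∀ x → A x ≡ true → x ≢ 0#) →
      let L = + q * ∣ A ∣ᶻ - ∣ sumset A ∣ᶻ * ∣ prodset A ∣ᶻ in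
      0ℤ ≤ L → (∣ A ∣ᶻ * L) * (∣ A ∣ᶻ * L) ≤ + q * + q * + q * ∣ sumset A ∣ᶻ * ∣ prodset A ∣ᶻ
    sum-product-bound-∣∣ᶻ A⊆Q* 0≤L = begin
      (∣ A ∣ᶻ * L) * (∣ A ∣ᶻ * L)
        ≡⟨ regroup ∣ A ∣ᶻ L ⟩
      ∣ A ∣ᶻ * (L * L) * ∣ A ∣ᶻ
        ≡⟨ cong (_* ∣ A ∣ᶻ) (∑-*ʳ (L * L) (χ A)) ⟨
      (∑[ b ] χ A b * (L * L)) * ∣ A ∣ᶻ
        ≡⟨ ∑-*ˡ (∑[ b ] χ A b * (L * L)) (χ A) ⟨
      ∑[ c ] (∑[ b ] χ A b * (L * L)) * χ A c
        ≤⟨ ∑-mono-≤ row ⟩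
      ∑ᴸ deviation²
        ≤⟨ line-variance-≤ S T ⟩
      + q * + q * + q * ∣ S ∣ᶻ * ∣ T ∣ᶻ
        ∎
      where
      open ℤₚ.≤-Reasoning
      S T : Subset
      S = sumset A
      T = prodset A
      L : ℤ
      L = + q * ∣ A ∣ᶻ - ∣ S ∣ᶻ * ∣ T ∣ᶻ
      deviation² : Carrier → Carrier → ℤ
      deviation² c b = deviation S T c b * deviation S T c b
      regroup : ∀ a l → (a * l) * (a * l) ≡ a * (l * l) * a
      regroup = solve-∀
      L≤deviation : ∀ {c b} → A c ≡ true → A b ≡ true → L ≤ deviation S T c b
      L≤deviation Ac Ab = ℤₚ.+-monoˡ-≤ (- (∣ S ∣ᶻ * ∣ T ∣ᶻ))
                            (ℤₚ.*-monoˡ-≤-nonNeg (+ q) (incidences-≥ Ac Ab))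
      column : ∀ {c} → A c ≡ true → ∀ b → χ A b * (L * L) ≤ deviation² c b
      column {c} Ac b with A b in Ab
      ... | false = 0≤i*i (deviation S T c b)
      ... | true  = ℤₚ.≤-trans (ℤₚ.≤-reflexive (ℤₚ.*-identityˡ (L * L)))
                               (*-mono-≤-nonNeg 0≤L 0≤L (L≤deviation Ac Ab) (L≤deviation Ac Ab))
      row : ∀ c → (∑[ b ] χ A b * (L * L)) * χ A c ≤ χ nonzero c * (∑[ b ] deviation² c b)
      row c with A c in Ac
      ... | false = ℤₚ.≤-trans (ℤₚ.≤-reflexive (ℤₚ.*-zeroʳ (∑[ b ] χ A b * (L * L))))
                               (0≤i*j (0≤χ nonzero c) (∑-nonneg (λ b → 0≤i*i (deviation S T c b))))
      ... | true  = begin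
        (∑[ b ] χ A b * (L * L)) * 1ℤ      ≡⟨ ℤₚ.*-identityʳ _ ⟩
        ∑[ b ] χ A b * (L * L)             ≤⟨ ∑-mono-≤ (column Ac) ⟩
        ∑[ b ] deviation² c b              ≡⟨ ℤₚ.*-identityˡ _ ⟨
        1ℤ * (∑[ b ] deviation² c b)       ≡⟨ cong (_* (∑[ b ] deviation² c b)) (χ-nonzero (A⊆Q* c Ac)) ⟨
        χ nonzero c * (∑[ b ] deviation² c b) ∎

    sum-product-bound : (∀ x → A x ≡ true → x ≢ 0#) →
      let L = + q * + ∣ A ∣ - + ∣ sumset A ∣ * + ∣ prodset A ∣ in
      0ℤ ≤ L → (+ ∣ A ∣ * L) * (+ ∣ A ∣ * L) ≤ + q * + q * + q * + ∣ sumset A ∣ * + ∣ prodset A ∣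
    sum-product-bound A⊆Q* =
      transport (∣∣≡∣∣ᶻ A) (∣∣≡∣∣ᶻ (sumset A)) (∣∣≡∣∣ᶻ (prodset A)) (sum-product-bound-∣∣ᶻ A⊆Q*)
      where
      Bound : ℤ → ℤ → ℤ → Set
      Bound a s t = let L = + q * a - s * t in 0ℤ ≤ L → (a * L) * (a * L) ≤ + q * + q * + q * s * t
      transport : ∀ {a a′ s s′ t t′} → a′ ≡ a → s′ ≡ s → t′ ≡ t → Bound a s t → Bound a′ s′ t′
      transport refl refl refl bound = bound

module NaturalBound where

  open import Data.Nat using (_*_; _∸_; _^_; _≤_; _≤?_; z≤n)
  open import Data.Integer using (+_; 0ℤ; +≤+) renaming (_*_ to _*ᶻ_; _-_ to _-ᶻ_; _≤_ to _≤ᶻ_)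
  import Data.Nat.Properties as ℕₚ
  import Data.Nat.Tactic.RingSolver as ℕ-Solver

  qa²∸mna≡a[qa∸mn] : ∀ q a m n → q * a ^ 2 ∸ m * n * a ≡ a * (q * a ∸ m * n)
  qa²∸mna≡a[qa∸mn] q a m n =
    trans (cong₂ _∸_ (reorder₁ q a) (reorder₂ m n a)) (sym (ℕₚ.*-distribˡ-∸ a (q * a) (m * n)))
    where
    reorder₁ : ∀ q a → q * (a * (a * 1)) ≡ a * (q * a)
    reorder₁ = ℕ-Solver.solve-∀
    reorder₂ : ∀ m n a → m * n * a ≡ a * (m * n)
    reorder₂ = ℕ-Solver.solve-∀

  square-bound-ℕ : ∀ q a m n →
    (let L = + q *ᶻ + a -ᶻ + m *ᶻ + n in
     0ℤ ≤ᶻ L → (+ a *ᶻ L) *ᶻ (+ a *ᶻ L) ≤ᶻ + q *ᶻ + q *ᶻ + q *ᶻ + m *ᶻ + n) →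
    (q * a ^ 2 ∸ m * n * a) ^ 2 ≤ q ^ 3 * m * n
  square-bound-ℕ q a m n bound with m * n ≤? q * a
  ... | yes mn≤qa = ℤₚ.drop‿+≤+ (subst₂ _≤ᶻ_ (sym lhs) (sym rhs) (bound (subst (0ℤ ≤ᶻ_) L≡ (+≤+ z≤n))))
    where
    d : ℕ
    d = q * a ^ 2 ∸ m * n * a
    L≡ : + (q * a ∸ m * n) ≡ + q *ᶻ + a -ᶻ + m *ᶻ + n
    L≡ = trans (sym (ℤₚ.⊖-≥ mn≤qa))
        (trans (sym (ℤₚ.m-n≡m⊖n (q * a) (m * n))) (cong₂ _-ᶻ_ (ℤₚ.pos-* q a) (ℤₚ.pos-* m n)))
    d≡ : + d ≡ + a *ᶻ (+ q *ᶻ + a -ᶻ + m *ᶻ + n)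
    d≡ = trans (cong +_ (qa²∸mna≡a[qa∸mn] q a m n)) (trans (ℤₚ.pos-* a _) (cong (+ a *ᶻ_) L≡))
    lhs : + (d ^ 2) ≡ (+ a *ᶻ (+ q *ᶻ + a -ᶻ + m *ᶻ + n)) *ᶻ (+ a *ᶻ (+ q *ᶻ + a -ᶻ + m *ᶻ + n))
    lhs = trans (cong (λ x → + (d * x)) (ℕₚ.*-identityʳ d)) (trans (ℤₚ.pos-* d d) (cong₂ _*ᶻ_ d≡ d≡))
    rhs : + (q ^ 3 * m * n) ≡ + q *ᶻ + q *ᶻ + q *ᶻ + m *ᶻ + n
    rhs = trans (cong +_ (cube q m n)) (trans (ℤₚ.pos-* (q * q * q * m) n) (cong (_*ᶻ + n)
          (trans (ℤₚ.pos-* (q * q * q) m) (cong (_*ᶻ + m) (trans (ℤₚ.pos-* (q * q) q) (cong (_*ᶻ + q) (ℤₚ.pos-* q q)))))))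
      where
      cube : ∀ q m n → q * (q * (q * 1)) * m * n ≡ q * q * q * m * n
      cube = ℕ-Solver.solve-∀
  ... | no mn≰qa = subst (_≤ q ^ 3 * m * n) (sym d²≡0) z≤n
    where
    d²≡0 : (q * a ^ 2 ∸ m * n * a) ^ 2 ≡ 0
    d²≡0 = cong (_^ 2) (trans (qa²∸mna≡a[qa∸mn] q a m n)
             (trans (cong (a *_) (ℕₚ.m≤n⇒m∸n≡0 (ℕₚ.<⇒≤ (ℕₚ.≰⇒> mn≰qa)))) (ℕₚ.*-zeroʳ a)))

open NaturalBound using (square-bound-ℕ)
open import Data.Nat using (_*_; _∸_; _^_; _≤_)

theorem1p4 : ∀ {ℓ : Level} (q : ℕ) (Q : FiniteQuasifield ℓ q) →
    let open FiniteQuasifield Q in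
    (A : Subset) → (∀ x → A x ≡ true → x ≢ 0#) →
    (m n : ℕ) → ∣ sumset A ∣ ≡ m → ∣ prodset A ∣ ≡ n →
    (q * ∣ A ∣ ^ 2 ∸ m * n * ∣ A ∣) ^ 2 ≤ q ^ 3 * m * n
theorem1p4 q Q A A⊆Q* _ _ refl refl =
  square-bound-ℕ q (∣ A ∣) (∣ sumset A ∣) (∣ prodset A ∣) (sum-product-bound A A⊆Q*)
  where
  open FiniteQuasifield Q
  open LineIncidences Q
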